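{- Let $G$ be a finite bipartite graph with color classes $A$ and $B$, $b:V(G)\to\mathbb{Z}_{\ge0}$, and $M$ a maximum $b$-matching of $G$. Let $X_A$, $X_B$ be the unions of the vertex sets of the inconsistent flexible components hooked up by $A$ and by $B$ respectively, let $V_0:=V(G)\setminus(X_A\cup X_B)$, and assume $V_0\ne\emptyset$. Let $H$ be the digraph on $V_0$ having, for each edge $uv$ of $G$ with $u\in A\cap V_0$, $v\in B\cap V_0$, the arc $(u,v)$ if $uv\in M$ and the arc $(v,u)$ if $uv\notin M$. Let $K_1,\dots,K_k$ be the strongly connected components of $H$. Then $\{V(K_i): 1\le i\le k\}=\{V(C): C\in\mathcal{C}\}$. Moreover, for $i,j$ with $V(K_i)=V(C)$ and $V(K_j)=V(C')$ ($C,C'\in\mathcal{C}$), there is a directed path in $H$ from $K_i$ to $K_j$ if and only if $C\le_A C'$.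
   Context: A $b$-matching is $M\subseteq E(G)$ with at most $b(v)$ edges of $M$ at each $v$; maximum = largest cardinality; $v$ is $M$-loose if fewer than $b(v)$ edges of $M$ are incident with it. An edge is allowed if in some maximum $b$-matching, forbidden otherwise; an allowed edge is inevitable if in every maximum $b$-matching, flexible otherwise. Flexible components: induced subgraphs $G[V(K)]$, $K$ a connected component of $(V(G),\{\text{flexible edges}\})$. $\mathcal{D}$: vertices $M'$-loose for some maximum $b$-matching $M'$. For $W\in\{A,B\}$, a flexible component $C$ is inconsistent hooked up by $W$ if $V(C)\cap\mathcal{D}\cap W\ne\emptyset$, or $C=G[\{v\}]$ with $b(v)=0$ and $v$ adjacent to a vertex of $\mathcal{D}\cap W$. $C$ is consistent if it meets no vertex of $\mathcal{D}$ and is not of the form $G[\{v\}]$ with $b(v)=0$ and $v$ adjacent to $\mathcal{D}$; $\mathcal{C}$ is the set of consistent flexible components. For flexible components $C,C'$, $C\preceq^\circ_A C'$ if $C=C'$, or an inevitable edge joins $V(C)\cap A$ to $V(C')\cap B$, or a forbidden edge joins $V(C')\cap A$ to $V(C)\cap B$. For $C,C'\in\mathcal{C}$, $C\le_A C'$ if there are $D_1=C,\dots,D_k=C'$ in $\mathcal{C}$ with $D_i\preceq^\circ_A D_{i+1}$ for all $i$. -}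

module Defs where

open import Level using (Level; _⊔_) renaming (zero to lzero; suc to lsuc)
open import Data.Nat using (ℕ; zero; suc; _+_; _≤_; _<_)
open import Data.Bool using (Bool; true; false)
open import Data.Fin using (Fin)
open import Data.Sum using (_⊎_; inj₁; inj₂)
open import Data.Product using (Σ; ∃; _×_; _,_)
open import Data.Unit using (⊤)
open import Data.Empty using (⊥)
open import Relation.Nullary using (¬_)
open import Relation.Binary.PropositionalEquality using (_≡_)
open import Relation.Binary.Construct.Closure.ReflexiveTransitive using (Star)

count : ∀ {n} → (Fin n → Bool) → ℕ
count {zero} f = 0
count {suc n} f with f Data.Fin.zero
... | true  = suc (count (λ i → f (Data.Fin.suc i)))
... | false = count (λ i → f (Data.Fin.suc i))

sumF : ∀ {n} → (Fin n → ℕ) → ℕ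
sumF {zero} f = 0
sumF {suc n} f = f Data.Fin.zero + sumF (λ i → f (Data.Fin.suc i))

_⇔_ : ∀ {a b} → Set a → Set b → Set (a ⊔ b)
P ⇔ Q = (P → Q) × (Q → P)

data Side : Set where
  sideA sideB : Side

-- Vertex set V(G) = Fin p ⊎ Fin q  (inj₁ = vertices of A, inj₂ = vertices of B).
module Graph {p q : ℕ} (E : Fin p → Fin q → Bool) (b : Fin p ⊎ Fin q → ℕ) where

  V : Set
  V = Fin p ⊎ Fin q

  EdgeSet : Set
  EdgeSet = Fin p → Fin q → Bool

  InSide : Side → V → Set
  InSide sideA (inj₁ _) = ⊤
  InSide sideA (inj₂ _) = ⊥
  InSide sideB (inj₁ _) = ⊥
  InSide sideB (inj₂ _) = ⊤

  Adj : V → V → Set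
  Adj (inj₁ i) (inj₂ j) = E i j ≡ true
  Adj (inj₂ j) (inj₁ i) = E i j ≡ true
  Adj _ _ = ⊥

  deg : EdgeSet → V → ℕ
  deg M (inj₁ i) = count (λ j → M i j)
  deg M (inj₂ j) = count (λ i → M i j)

  size : EdgeSet → ℕ
  size M = sumF (λ i → count (λ j → M i j))

  IsBMatching : EdgeSet → Set
  IsBMatching M = (∀ i j → M i j ≡ true → E i j ≡ true) × (∀ v → deg M v ≤ b v)

  IsMaxBMatching : EdgeSet → Set
  IsMaxBMatching M = IsBMatching M × (∀ M' → IsBMatching M' → size M' ≤ size M)

  Loose : EdgeSet → V → Set
  Loose M v = deg M v < b v

  Allowed : Fin p → Fin q → Set
  Allowed i j = E i j ≡ true × ∃ λ M → IsMaxBMatching M × M i j ≡ true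

  Forbidden : Fin p → Fin q → Set
  Forbidden i j = E i j ≡ true × ¬ Allowed i j

  Inevitable : Fin p → Fin q → Set
  Inevitable i j = Allowed i j × (∀ M → IsMaxBMatching M → M i j ≡ true)

  Flexible : Fin p → Fin q → Set
  Flexible i j = Allowed i j × ¬ Inevitable i j

  FlexAdj : V → V → Set
  FlexAdj (inj₁ i) (inj₂ j) = Flexible i j
  FlexAdj (inj₂ j) (inj₁ i) = Flexible i j
  FlexAdj _ _ = ⊥

  -- S is the vertex set of a flexible component: a connected component of
  -- (V(G), flexible edges), given as the set of vertices reachable from some v.
  IsFlexComp : (V → Set) → Set
  IsFlexComp S = ∃ λ v → ∀ w → S w ⇔ Star FlexAdj v w

  𝒟 : V → Set
  𝒟 v = ∃ λ M' → IsMaxBMatching M' × Loose M' v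

  SingletonZeroNextTo : (V → Set) → (V → Set) → Set
  SingletonZeroNextTo S P =
    ∃ λ v → (∀ w → S w ⇔ (w ≡ v)) × b v ≡ 0 × ∃ λ u → Adj v u × 𝒟 u × P u

  HookedUp : Side → (V → Set) → Set
  HookedUp W S = IsFlexComp S ×
    ((∃ λ v → S v × 𝒟 v × InSide W v) ⊎ SingletonZeroNextTo S (InSide W))

  Consistent : (V → Set) → Set
  Consistent S = IsFlexComp S × ¬ (∃ λ v → S v × 𝒟 v)
                 × ¬ SingletonZeroNextTo S (λ _ → ⊤)

  X : Side → V → Set₁
  X W x = Σ (V → Set) λ S → HookedUp W S × S x

  V₀ : V → Set₁
  V₀ x = ¬ X sideA x × ¬ X sideB x

  Arc : EdgeSet → V → V → Set₁
  Arc M (inj₁ i) (inj₂ j) = V₀ (inj₁ i) × V₀ (inj₂ j) × E i j ≡ true × M i j ≡ true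
  Arc M (inj₂ j) (inj₁ i) = V₀ (inj₁ i) × V₀ (inj₂ j) × E i j ≡ true × M i j ≡ false
  Arc M _ _ = Level.Lift _ ⊥

  Reach : EdgeSet → V → V → Set₁
  Reach M = Star (Arc M)

  IsSCC : EdgeSet → (V → Set₁) → Set₁
  IsSCC M K = ∃ λ u → V₀ u × ∀ w → K w ⇔ (V₀ w × Reach M u w × Reach M w u)

  PathBetween : EdgeSet → (V → Set₁) → (V → Set₁) → Set₁
  PathBetween M K K' = ∃ λ x → ∃ λ y → K x × K' y × Reach M x y

  SameSet : ∀ {ℓ ℓ'} → (V → Set ℓ) → (V → Set ℓ') → Set (ℓ ⊔ ℓ')
  SameSet S T = ∀ w → S w ⇔ T w

  PreA : (V → Set) → (V → Set) → Set₁
  PreA C C' = SameSet C C'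
    ⊎ Level.Lift (lsuc lzero) (∃ λ i → ∃ λ j → Inevitable i j × C (inj₁ i) × C' (inj₂ j))
    ⊎ Level.Lift (lsuc lzero) (∃ λ i → ∃ λ j → Forbidden i j × C' (inj₁ i) × C (inj₂ j))

  data LeA : (V → Set) → (V → Set) → Set₁ where
    single : ∀ {C} → Consistent C → LeA C C
    step   : ∀ {C C' C''} → Consistent C → PreA C C' → LeA C' C'' → LeA C C''

-- Two exchange arguments identify strong connectivity in H with flexible connectivity.
-- If an arc of H lies on a directed cycle, toggling M along a simple such cycle changes no
-- degree (matched edges point A → B, unmatched ones B → A, and they alternate), so this gives
-- a maximum b-matching disagreeing with M on the arc: its edge is flexible.  Conversely, for an
-- arc x → y whose edge is flexible, pick a maximum M′ disagreeing with M there and orient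
-- M ∖ M′ from A to B and M′ ∖ M from B to A; these are arcs of H.  The flexible component of x
-- avoids 𝒟, so all its vertices are saturated by both M and M′ and have equal in- and
-- out-degree; double counting then shows that no arc enters the set of vertices reachable
-- from y, whence y reaches x.  Between different components an arc of H is an inevitable
-- edge (oriented A → B) or a forbidden one (oriented B → A): exactly the steps of ⪯°_A.
-- Deciding which case occurs is done by exhaustive search over all edge sets.

module Submission where

open import Defs
open import Level using (Level; lift; 0ℓ)
open import Function using (id; _∘_; case_of_)
open import Data.Nat using (ℕ; zero; suc; _+_; _≤_; _<_; z≤n; s≤s; _≤?_)
open import Data.Nat.Properties
open import Data.Bool using (Bool; true; false; _∧_; _∨_; not; _xor_)
import Data.Bool.Properties as Boolₚ
open import Data.Fin using (Fin)
import Data.Fin as Fin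
import Data.Fin.Properties as Finₚ
open import Data.Sum using (_⊎_; inj₁; inj₂)
import Data.Sum.Properties as Sumₚ
open import Data.Product using (Σ; ∃; _×_; _,_; proj₁; proj₂; swap)
open import Data.Product.Properties using () renaming (≡-dec to ×-≡-dec)
open import Data.List using (List; []; _∷_; _++_)
open import Data.List.Relation.Unary.Any using (here; there)
open import Data.Unit using (⊤; tt)
open import Data.Empty using (⊥; ⊥-elim)
open import Relation.Nullary using (¬_; Dec; yes; no; does)
open import Relation.Nullary.Decidable using (dec-true; dec-false; map′; _×-dec_; _→-dec_)
open import Relation.Binary.PropositionalEquality
open import Relation.Binary using (Rel; Reflexive; _Respects_; DecidableEquality)
open import Relation.Unary using (Pred; Decidable)
open import Data.Vec.Functional using (Vector; head; tail) renaming (_∷_ to _∷ᵥ_)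
open import Data.Vec.Functional.Relation.Binary.Pointwise using (Pointwise)
open import Relation.Binary.Construct.Closure.ReflexiveTransitive as Star using (Star; ε; _◅_; _◅◅_)
open import Algebra.Properties.CommutativeSemigroup +-commutativeSemigroup
  using () renaming (interchange to +-interchange)

does-true⇒ : ∀ {A : Set} (a? : Dec A) → does a? ≡ true → A
does-true⇒ (yes a) _ = a

fromBool : Bool → ℕ
fromBool true  = 1
fromBool false = 0

fromBool-mono : ∀ {a c} → (a ≡ true → c ≡ true) → fromBool a ≤ fromBool c
fromBool-mono {false} _ = z≤n
fromBool-mono {true}  h rewrite h refl = ≤-refl

fromBool-mono-< : ∀ {a c} → a ≡ false → c ≡ true → fromBool a < fromBool c
fromBool-mono-< refl refl = ≤-refl

sumF-cong : ∀ {n} (f g : Fin n → ℕ) → (∀ k → f k ≡ g k) → sumF f ≡ sumF g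
sumF-cong {zero}  f g f≗g = refl
sumF-cong {suc n} f g f≗g = cong₂ _+_ (f≗g Fin.zero) (sumF-cong _ _ (f≗g ∘ Fin.suc))

sumF-mono-≤ : ∀ {n} (f g : Fin n → ℕ) → (∀ k → f k ≤ g k) → sumF f ≤ sumF g
sumF-mono-≤ {zero}  f g f≤g = z≤n
sumF-mono-≤ {suc n} f g f≤g = +-mono-≤ (f≤g Fin.zero) (sumF-mono-≤ _ _ (f≤g ∘ Fin.suc))

sumF-mono-< : ∀ {n} (f g : Fin n → ℕ) → (∀ k → f k ≤ g k) → ∀ k₀ → f k₀ < g k₀ → sumF f < sumF g
sumF-mono-< {suc n} f g f≤g Fin.zero     lt = +-mono-<-≤ lt (sumF-mono-≤ _ _ (f≤g ∘ Fin.suc))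
sumF-mono-< {suc n} f g f≤g (Fin.suc k₀) lt = +-mono-≤-< (f≤g Fin.zero) (sumF-mono-< _ _ (f≤g ∘ Fin.suc) k₀ lt)

sumF-≥-term : ∀ {n} (f : Fin n → ℕ) k → f k ≤ sumF f
sumF-≥-term f Fin.zero    = m≤m+n _ _
sumF-≥-term f (Fin.suc k) = ≤-trans (sumF-≥-term (f ∘ Fin.suc) k) (m≤n+m _ (f Fin.zero))

sumF-distrib-+ : ∀ {n} (f g : Fin n → ℕ) → sumF (λ k → f k + g k) ≡ sumF f + sumF g
sumF-distrib-+ {zero}  f g = refl
sumF-distrib-+ {suc n} f g = begin
  (f₀ + g₀) + sumF (λ k → f (Fin.suc k) + g (Fin.suc k))
    ≡⟨ cong ((f₀ + g₀) +_) (sumF-distrib-+ (f ∘ Fin.suc) (g ∘ Fin.suc)) ⟩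
  (f₀ + g₀) + (sumF (f ∘ Fin.suc) + sumF (g ∘ Fin.suc))   ≡⟨ +-interchange f₀ g₀ _ _ ⟩
  (f₀ + sumF (f ∘ Fin.suc)) + (g₀ + sumF (g ∘ Fin.suc))   ∎
  where open ≡-Reasoning
        f₀ = f Fin.zero
        g₀ = g Fin.zero

sumF-zero : ∀ {n} → sumF {n} (λ _ → 0) ≡ 0
sumF-zero {zero}  = refl
sumF-zero {suc n} = sumF-zero {n}

sumF-comm : ∀ {m n} (f : Fin m → Fin n → ℕ) →
  sumF (λ i → sumF (λ j → f i j)) ≡ sumF (λ j → sumF (λ i → f i j))
sumF-comm {zero}  {n} f = sym (sumF-zero {n})
sumF-comm {suc m} {n} f =
  trans (cong (sumF (f Fin.zero) +_) (sumF-comm (f ∘ Fin.suc)))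
        (sym (sumF-distrib-+ (f Fin.zero) (λ j → sumF (λ i → f (Fin.suc i) j))))

count≡sumF : ∀ {n} (f : Fin n → Bool) → count f ≡ sumF (fromBool ∘ f)
count≡sumF {zero}  f = refl
count≡sumF {suc n} f with f Fin.zero
... | true  = cong suc (count≡sumF (f ∘ Fin.suc))
... | false = count≡sumF (f ∘ Fin.suc)

∧-elim : ∀ {a c} → a ∧ c ≡ true → a ≡ true × c ≡ true
∧-elim {true} {true} _ = refl , refl

count-cong : ∀ {n} (f g : Fin n → Bool) → (∀ k → f k ≡ g k) → count f ≡ count g
count-cong f g f≗g = begin
  count f                 ≡⟨ count≡sumF f ⟩
  sumF (fromBool ∘ f)     ≡⟨ sumF-cong _ _ (cong fromBool ∘ f≗g) ⟩
  sumF (fromBool ∘ g)     ≡⟨ count≡sumF g ⟨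
  count g                 ∎
  where open ≡-Reasoning

count-mono-≤ : ∀ {n} (f g : Fin n → Bool) → (∀ k → f k ≡ true → g k ≡ true) → count f ≤ count g
count-mono-≤ f g f⊆g rewrite count≡sumF f | count≡sumF g =
  sumF-mono-≤ _ _ (fromBool-mono ∘ f⊆g)

count-mono-< : ∀ {n} (f g : Fin n → Bool) → (∀ k → f k ≡ true → g k ≡ true) →
  ∀ k₀ → f k₀ ≡ false → g k₀ ≡ true → count f < count g
count-mono-< f g f⊆g k₀ fk₀ gk₀ rewrite count≡sumF f | count≡sumF g =
  sumF-mono-< _ _ (fromBool-mono ∘ f⊆g) k₀ (fromBool-mono-< fk₀ gk₀)

count-pos : ∀ {n} (f : Fin n → Bool) k → f k ≡ true → 1 ≤ count f
count-pos f k fk rewrite count≡sumF f = subst (_≤ sumF (fromBool ∘ f)) (cong fromBool fk) (sumF-≥-term _ k)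

count-≤ : ∀ {n} (f : Fin n → Bool) → count f ≤ n
count-≤ {zero}  f = z≤n
count-≤ {suc n} f with f Fin.zero
... | true  = s≤s (count-≤ (f ∘ Fin.suc))
... | false = m≤n⇒m≤1+n (count-≤ (f ∘ Fin.suc))

count-false : ∀ {n} (f : Fin n → Bool) → (∀ k → f k ≡ false) → count f ≡ 0
count-false {zero}  f f≗false = refl
count-false {suc n} f f≗false with f Fin.zero | f≗false Fin.zero
... | false | _ = count-false (f ∘ Fin.suc) (f≗false ∘ Fin.suc)

count-≤1 : ∀ {n} (f : Fin n → Bool) → (∀ k k' → f k ≡ true → f k' ≡ true → k ≡ k') → count f ≤ 1
count-≤1 {zero}  f unique = z≤n
count-≤1 {suc n} f unique with f Fin.zero in f₀
... | true  = ≤-reflexive (cong suc (count-false (f ∘ Fin.suc) rest-false))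
  where
    rest-false : ∀ k → f (Fin.suc k) ≡ false
    rest-false k with f (Fin.suc k) in fk
    ... | false = refl
    ... | true  with unique Fin.zero (Fin.suc k) f₀ fk
    ... | ()
... | false = count-≤1 (f ∘ Fin.suc) (λ k k' fk fk' → Finₚ.suc-injective (unique _ _ fk fk'))

count-∧-split : ∀ {n} (f g : Fin n → Bool) → count f ≡ count (λ k → f k ∧ g k) + count (λ k → f k ∧ not (g k))
count-∧-split f g
  rewrite count≡sumF f | count≡sumF (λ k → f k ∧ g k) | count≡sumF (λ k → f k ∧ not (g k)) =
  trans (sumF-cong _ _ (λ k → split (f k) (g k)))
        (sumF-distrib-+ (λ k → fromBool (f k ∧ g k)) (λ k → fromBool (f k ∧ not (g k))))
  where
    split : ∀ a c → fromBool a ≡ fromBool (a ∧ c) + fromBool (a ∧ not c)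
    split true  true  = refl
    split true  false = refl
    split false c     = refl

count-∨-≤ : ∀ {n} (f g : Fin n → Bool) → count (λ k → f k ∨ g k) ≤ count f + count g
count-∨-≤ f g rewrite count≡sumF (λ k → f k ∨ g k) | count≡sumF f | count≡sumF g =
  ≤-trans (sumF-mono-≤ _ _ (λ k → fromBool-∨ (f k) (g k)))
          (≤-reflexive (sumF-distrib-+ (fromBool ∘ f) (fromBool ∘ g)))
  where
    fromBool-∨ : ∀ a c → fromBool (a ∨ c) ≤ fromBool a + fromBool c
    fromBool-∨ true  c = s≤s z≤n
    fromBool-∨ false c = ≤-refl

count₂ : ∀ {m n} → (Fin m → Fin n → Bool) → ℕ
count₂ f = sumF (λ i → count (f i))

count₂-mono-≤ : ∀ {m n} (f g : Fin m → Fin n → Bool) → (∀ i j → f i j ≡ true → g i j ≡ true) →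
  count₂ f ≤ count₂ g
count₂-mono-≤ f g f⊆g = sumF-mono-≤ _ _ (λ i → count-mono-≤ (f i) (g i) (f⊆g i))

count₂-mono-< : ∀ {m n} (f g : Fin m → Fin n → Bool) → (∀ i j → f i j ≡ true → g i j ≡ true) →
  ∀ i₀ j₀ → f i₀ j₀ ≡ false → g i₀ j₀ ≡ true → count₂ f < count₂ g
count₂-mono-< f g f⊆g i₀ j₀ fij gij =
  sumF-mono-< _ _ (λ i → count-mono-≤ (f i) (g i) (f⊆g i)) i₀ (count-mono-< (f i₀) (g i₀) (f⊆g i₀) j₀ fij gij)

count₂-transpose : ∀ {m n} (f : Fin m → Fin n → Bool) → count₂ f ≡ count₂ (λ j i → f i j)
count₂-transpose f = begin
  sumF (λ i → count (f i))                      ≡⟨ sumF-cong _ _ (λ i → count≡sumF (f i)) ⟩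
  sumF (λ i → sumF (λ j → fromBool (f i j)))    ≡⟨ sumF-comm (λ i j → fromBool (f i j)) ⟩
  sumF (λ j → sumF (λ i → fromBool (f i j)))    ≡⟨ sumF-cong _ _ (λ j → count≡sumF (λ i → f i j)) ⟨
  sumF (λ j → count (λ i → f i j))              ∎
  where open ≡-Reasoning

count₂-rows : ∀ {m n} (r : Fin m → Bool) (f g : Fin m → Fin n → Bool) →
  (∀ i → r i ≡ true → count (f i) ≡ count (g i)) →
  count₂ (λ i j → r i ∧ f i j) ≡ count₂ (λ i j → r i ∧ g i j)
count₂-rows r f g same-rows = sumF-cong _ _ row
  where
    row : ∀ i → count (λ j → r i ∧ f i j) ≡ count (λ j → r i ∧ g i j)
    row i with r i in ri
    ... | true  = same-rows i ri
    ... | false = refl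

count-grows : ∀ {n} (r r′ : Fin n → Bool) → (∀ {k} → r k ≡ true → r′ k ≡ true) →
  ¬ (∀ k → r′ k ≡ r k) → count r < count r′
count-grows {n} r r′ r⊆r′ r′≢r with Finₚ.¬∀⟶∃¬ n _ (λ k → r′ k Boolₚ.≟ r k) r′≢r
... | k , r′k≢rk with r k in rk
...   | true  = ⊥-elim (r′k≢rk (r⊆r′ rk))
...   | false with r′ k in r′k
...     | true  = count-mono-< r r′ (λ k → r⊆r′) k rk r′k
...     | false = ⊥-elim (r′k≢rk refl)

count-differences : ∀ {n} (f g : Fin n → Bool) → count f ≡ count g →
  count (λ k → f k ∧ not (g k)) ≡ count (λ k → g k ∧ not (f k))
count-differences f g f≡g = +-cancelˡ-≡ _ _ _ (begin
  count (λ k → f k ∧ g k) + count (λ k → f k ∧ not (g k)) ≡⟨ count-∧-split f g ⟨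
  count f                                                 ≡⟨ f≡g ⟩
  count g                                                 ≡⟨ count-∧-split g f ⟩
  count (λ k → g k ∧ f k) + count (λ k → g k ∧ not (f k)) ≡⟨ cong (_+ count (λ k → g k ∧ not (f k)))
                                                               (count-cong _ _ (λ k → Boolₚ.∧-comm (g k) (f k))) ⟩
  count (λ k → f k ∧ g k) + count (λ k → g k ∧ not (f k)) ∎)
  where open ≡-Reasoning

count-xor-preserved : ∀ {n} (m g₁ g₂ : Fin n → Bool) →
  (∀ k → g₁ k ≡ true → m k ≡ true) → (∀ k → g₂ k ≡ true → m k ≡ false) →
  count g₁ ≡ count g₂ → count (λ k → m k xor (g₁ k ∨ g₂ k)) ≡ count m
count-xor-preserved m g₁ g₂ g₁⊆m g₂∩m≡∅ g₁≡g₂ = begin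
  count m′                                       ≡⟨ count-∧-split m′ m ⟩
  count (λ k → m′ k ∧ m k) + count (λ k → m′ k ∧ not (m k))
                                                 ≡⟨ cong₂ _+_ (count-cong _ _ kept) (count-cong _ _ added) ⟩
  count kept′ + count g₂                         ≡⟨ +-comm (count kept′) _ ⟩
  count g₂ + count kept′                         ≡⟨ cong (_+ count kept′) (sym g₁≡g₂) ⟩
  count g₁ + count kept′                         ≡⟨ cong (_+ count kept′) (count-cong _ _ removed) ⟩
  count (λ k → m k ∧ (g₁ k ∨ g₂ k)) + count kept′ ≡⟨ count-∧-split m (λ k → g₁ k ∨ g₂ k) ⟨
  count m                                        ∎
  where
    open ≡-Reasoning
    m′ kept′ : Fin _ → Bool
    m′ k = m k xor (g₁ k ∨ g₂ k)
    kept′ k = m k ∧ not (g₁ k ∨ g₂ k)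

    kept : ∀ k → m′ k ∧ m k ≡ kept′ k
    kept k with m k | g₁ k | g₂ k
    ... | true  | true  | _     = refl
    ... | true  | false | true  = refl
    ... | true  | false | false = refl
    ... | false | _     | _     = Boolₚ.∧-zeroʳ _

    added : ∀ k → m′ k ∧ not (m k) ≡ g₂ k
    added k with m k in mk | g₁ k in g₁k | g₂ k in g₂k
    ... | true  | _     | true  = case trans (sym mk) (g₂∩m≡∅ k g₂k) of λ ()
    ... | true  | _     | false = Boolₚ.∧-zeroʳ _
    ... | false | true  | _     = case trans (sym (g₁⊆m k g₁k)) mk of λ ()
    ... | false | false | _     = Boolₚ.∧-identityʳ _

    removed : ∀ k → g₁ k ≡ m k ∧ (g₁ k ∨ g₂ k)
    removed k with m k in mk | g₁ k in g₁k | g₂ k in g₂k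
    ... | true  | true  | _     = refl
    ... | true  | false | true  = case trans (sym mk) (g₂∩m≡∅ k g₂k) of λ ()
    ... | true  | false | false = refl
    ... | false | true  | _     = case trans (sym (g₁⊆m k g₁k)) mk of λ ()
    ... | false | false | _     = refl

Searchable : (B : Set) → Rel B 0ℓ → Set₁
Searchable B _≈_ = (P : Pred B 0ℓ) → P Respects _≈_ → Decidable P → Dec (∃ P)

search-Bool : Searchable Bool _≡_
search-Bool P resp P? with P? true | P? false
... | yes pt | _      = yes (true , pt)
... | no _   | yes pf = yes (false , pf)
... | no ¬pt | no ¬pf = no λ { (true , pt) → ¬pt pt ; (false , pf) → ¬pf pf }

search-Vector : ∀ n {B : Set} {_≈_ : Rel B 0ℓ} → Reflexive _≈_ →
  Searchable B _≈_ → Searchable (Vector B n) (Pointwise _≈_)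
search-Vector zero refl≈ search-B P resp P? with P? (λ ())
... | yes p = yes (_ , p)
... | no ¬p = no λ (f , pf) → ¬p (resp (λ ()) pf)
search-Vector (suc n) {B} {_≈_} refl≈ search-B P resp P? with search-B Q resp-Q Q?
  where
    Q : Pred B 0ℓ
    Q x = ∃ λ xs → P (x ∷ᵥ xs)

    cons-resp : ∀ {x y xs ys} → x ≈ y → Pointwise _≈_ xs ys → Pointwise _≈_ (x ∷ᵥ xs) (y ∷ᵥ ys)
    cons-resp x≈y xs≈ys Fin.zero    = x≈y
    cons-resp x≈y xs≈ys (Fin.suc k) = xs≈ys k

    resp-Q : Q Respects _≈_
    resp-Q x≈y (xs , p) = xs , resp (cons-resp x≈y (λ k → refl≈)) p

    Q? : Decidable Q
    Q? x = search-Vector n refl≈ search-B (λ xs → P (x ∷ᵥ xs))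
             (λ xs≈ys → resp (cons-resp refl≈ xs≈ys)) (λ xs → P? (x ∷ᵥ xs))
... | yes (x , xs , p) = yes (x ∷ᵥ xs , p)
... | no ¬q = no λ (f , pf) → ¬q (head f , tail f , resp (head∷tail f) pf)
  where
    head∷tail : ∀ f → Pointwise _≈_ f (head f ∷ᵥ tail f)
    head∷tail f Fin.zero    = refl≈
    head∷tail f (Fin.suc k) = refl≈

module Walks {I : Set} (_≟_ : DecidableEquality I) where

  _==_ : I → I → Bool
  x == y = does (x ≟ y)

  _≟ₚ_ : DecidableEquality (I × I)
  _≟ₚ_ = ×-≡-dec _≟_ _≟_

  open import Data.List.Membership.DecPropositional _≟ₚ_ using (_∈_; _∈?_) public

  occurrences : ∀ {A : Set} → (A → Bool) → List A → ℕ
  occurrences P []       = 0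
  occurrences P (x ∷ xs) = fromBool (P x) + occurrences P xs

  occurrences-++ : ∀ {A : Set} (P : A → Bool) xs ys →
    occurrences P (xs ++ ys) ≡ occurrences P xs + occurrences P ys
  occurrences-++ P []       ys = refl
  occurrences-++ P (x ∷ xs) ys =
    trans (cong (fromBool (P x) +_) (occurrences-++ P xs ys)) (sym (+-assoc (fromBool (P x)) _ _))

  occurrences-++ʳ : ∀ {A : Set} (P : A → Bool) xs ys → occurrences P ys ≤ occurrences P (xs ++ ys)
  occurrences-++ʳ P xs ys = subst (occurrences P ys ≤_) (sym (occurrences-++ P xs ys)) (m≤n+m _ _)

  occ : I → List I → ℕ
  occ u = occurrences (_== u)

  outdegree indegree : I → List (I × I) → ℕ
  outdegree u = occurrences ((_== u) ∘ proj₁)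
  indegree  u = occurrences ((_== u) ∘ proj₂)

  module _ {ℓ : Level} {R : Rel I ℓ} where

    sources : ∀ {a c} → Star R a c → List I
    sources ε            = []
    sources {a} (_ ◅ w) = a ∷ sources w

    arcs : ∀ {a c} → Star R a c → List (I × I)
    arcs ε                       = []
    arcs {a} (_◅_ {j = m} _ w) = (a , m) ∷ arcs w

    outdegree≡occ : ∀ u {a c} (w : Star R a c) → outdegree u (arcs w) ≡ occ u (sources w)
    outdegree≡occ u ε             = refl
    outdegree≡occ u {a} (_ ◅ w) = cong (fromBool (a == u) +_) (outdegree≡occ u w)

    walk-balance : ∀ u {a c} (w : Star R a c) →
      outdegree u (arcs w) + fromBool (c == u) ≡ indegree u (arcs w) + fromBool (a == u)
    walk-balance u ε = refl
    walk-balance u {a} {c} (_◅_ {j = m} _ w) = begin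
      (⟦ a ⟧ + outdegree u (arcs w)) + ⟦ c ⟧ ≡⟨ +-assoc ⟦ a ⟧ _ _ ⟩
      ⟦ a ⟧ + (outdegree u (arcs w) + ⟦ c ⟧) ≡⟨ cong (⟦ a ⟧ +_) (walk-balance u w) ⟩
      ⟦ a ⟧ + (indegree u (arcs w) + ⟦ m ⟧)  ≡⟨ +-comm ⟦ a ⟧ _ ⟩
      (indegree u (arcs w) + ⟦ m ⟧) + ⟦ a ⟧  ≡⟨ cong (_+ ⟦ a ⟧) (+-comm (indegree u (arcs w)) ⟦ m ⟧) ⟩
      (⟦ m ⟧ + indegree u (arcs w)) + ⟦ a ⟧  ∎
      where open ≡-Reasoning
            ⟦_⟧ : I → ℕ
            ⟦ x ⟧ = fromBool (x == u)

    closed-walk-balance : ∀ u {a} (w : Star R a a) → outdegree u (arcs w) ≡ indegree u (arcs w)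
    closed-walk-balance u w = +-cancelʳ-≡ _ _ _ (walk-balance u w)

    ∈-arcs⇒R : ∀ {s t a c} (w : Star R a c) → (s , t) ∈ arcs w → R s t
    ∈-arcs⇒R (r ◅ w) (here refl) = r
    ∈-arcs⇒R (r ◅ w) (there s∈w) = ∈-arcs⇒R w s∈w

    Simple : ∀ {a c} → Star R a c → Set
    Simple {c = c} w = (∀ u → occ u (sources w) ≤ 1) × occ c (sources w) ≡ 0

    suffix-from : ∀ a {s c} (w : Star R s c) → 1 ≤ occ a (sources w) →
      Σ (Star R a c) λ w′ → ∃ λ pre → sources w ≡ pre ++ sources w′
    suffix-from a {s} (r ◅ w) a∈w with s ≟ a
    ... | yes refl = r ◅ w , [] , refl
    ... | no _ with suffix-from a w a∈w
    ... | w′ , pre , w≡pre++w′ = w′ , s ∷ pre , cong (s ∷_) w≡pre++w′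

    Simple-suffix : ∀ {a b c} (w : Star R a c) (w′ : Star R b c) pre →
      sources w ≡ pre ++ sources w′ → Simple w → Simple w′
    Simple-suffix {c = c} w w′ pre w≡pre++w′ (≤1 , c∉w) =
      (λ u → ≤-trans (sub u) (≤1 u)) , n≤0⇒n≡0 (subst (occ c (sources w′) ≤_) c∉w (sub c))
      where
        sub : ∀ u → occ u (sources w′) ≤ occ u (sources w)
        sub u = subst (λ l → occ u (sources w′) ≤ occ u l) (sym w≡pre++w′) (occurrences-++ʳ _ pre _)

    erase-loops : ∀ {a c} (w : Star R a c) → Σ (Star R a c) Simple
    erase-loops ε = ε , (λ _ → z≤n) , refl
    erase-loops {a} {c} (r ◅ w) with erase-loops w
    ... | w′ , simple@(≤1 , c∉w′) with a ≟ c
    ...   | yes refl = ε , (λ _ → z≤n) , refl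
    ...   | no a≢c with occ a (sources w′) in a∈w′
    ...     | zero =
      r ◅ w′ , ≤1′ , trans (cong (λ x → fromBool x + occ c (sources w′)) (dec-false (a ≟ c) a≢c)) c∉w′
      where
        ≤1′ : ∀ u → fromBool (a == u) + occ u (sources w′) ≤ 1
        ≤1′ u with a ≟ u
        ... | yes refl = ≤-reflexive (cong suc a∈w′)
        ... | no _     = ≤1 u
    ...     | suc _ with suffix-from a w′ (subst (1 ≤_) (sym a∈w′) (s≤s z≤n))
    ...       | w″ , pre , w′≡pre++w″ = w″ , Simple-suffix w′ w″ pre w′≡pre++w″ simple

  occurrences-witness : ∀ (P : I × I → Bool) L → 1 ≤ occurrences P L → ∃ λ e → e ∈ L × P e ≡ true
  occurrences-witness P (e ∷ L) pos with P e in Pe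
  ... | true  = e , here refl , Pe
  ... | false with occurrences-witness P L pos
  ...   | e′ , e′∈L , Pe′ = e′ , there e′∈L , Pe′

  module _ {n : ℕ} (h : Fin n → I × I) (h-injective : ∀ {k k′} → h k ≡ h k′ → k ≡ k′)
           (P : I × I → Bool) (P∘h : ∀ k → P (h k) ≡ true) where

    count-∈-≤ : ∀ L → count (λ k → does (h k ∈? L)) ≤ occurrences P L
    count-∈-≤ []      = ≤-reflexive (count-false {n} (λ _ → false) (λ _ → refl))
    count-∈-≤ (e ∷ L) =
      ≤-trans (count-∨-≤ (λ k → does (h k ≟ₚ e)) (λ k → does (h k ∈? L))) (+-mono-≤ hits-e (count-∈-≤ L))
      where
        hits-e : count (λ k → does (h k ≟ₚ e)) ≤ fromBool (P e)
        hits-e with P e in Pe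
        ... | true  = count-≤1 _ (λ k k′ hk≡e hk′≡e →
                        h-injective (trans (does-true⇒ (h k ≟ₚ e) hk≡e) (sym (does-true⇒ (h k′ ≟ₚ e) hk′≡e))))
        ... | false = ≤-reflexive (count-false _ (λ k → dec-false (h k ≟ₚ e) (hk≢e k)))
          where
            hk≢e : ∀ k → h k ≢ e
            hk≢e k refl = case trans (sym (P∘h k)) Pe of λ ()

    count-∈≡occurrences : ∀ L → occurrences P L ≤ 1 → (∀ {e} → e ∈ L → P e ≡ true → ∃ λ k → h k ≡ e) →
      count (λ k → does (h k ∈? L)) ≡ occurrences P L
    count-∈≡occurrences L ≤1 covered with occurrences P L in occ≡ | count-∈-≤ L
    ... | zero  | ≤0 = n≤0⇒n≡0 ≤0
    ... | suc zero | ≤1′ with occurrences-witness P L (≤-reflexive (sym occ≡))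
    ...   | e , e∈L , Pe with covered e∈L Pe
    ...     | k , refl = ≤-antisym ≤1′ (count-pos _ k (dec-true (h k ∈? L) e∈L))
    count-∈≡occurrences L (s≤s ()) covered | suc (suc _) | _

module Regions {p q : ℕ} (forward backward : Fin p → Fin q → Bool) where

  Vertex : Set
  Vertex = Fin p ⊎ Fin q

  Arcᴰ : Rel Vertex 0ℓ
  Arcᴰ (inj₁ i) (inj₂ j) = forward i j ≡ true
  Arcᴰ (inj₂ j) (inj₁ i) = backward i j ≡ true
  Arcᴰ _        _        = ⊥

  outdeg indeg : Vertex → ℕ
  outdeg (inj₁ i) = count (forward i)
  outdeg (inj₂ j) = count (λ i → backward i j)
  indeg  (inj₁ i) = count (backward i)
  indeg  (inj₂ j) = count (λ i → forward i j)

  Region : Set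
  Region = (Fin p → Bool) × (Fin q → Bool)

  _∈ᴿ_ : Vertex → Region → Set
  inj₁ i ∈ᴿ (rA , rB) = rA i ≡ true
  inj₂ j ∈ᴿ (rA , rB) = rB j ≡ true

  _⊆ᴿ_ : Region → Region → Set
  R ⊆ᴿ R′ = ∀ {v} → v ∈ᴿ R → v ∈ᴿ R′

  Closed : Region → Set
  Closed R = ∀ {u v} → Arcᴰ u v → u ∈ᴿ R → v ∈ᴿ R

  Balanced : Region → Set
  Balanced R = ∀ v → v ∈ᴿ R → outdeg v ≡ indeg v

  any-true : ∀ {n} → (Fin n → Bool) → Bool
  any-true f = does (Finₚ.any? λ k → f k Boolₚ.≟ true)

  step : Region → Region
  step (rA , rB) = (λ i → rA i ∨ any-true (λ j → rB j ∧ backward i j)) ,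
                   (λ j → rB j ∨ any-true (λ i → rA i ∧ forward i j))

  step-⊇ : ∀ R → R ⊆ᴿ step R
  step-⊇ R {inj₁ i} rAi = cong (_∨ _) rAi
  step-⊇ R {inj₂ j} rBj = cong (_∨ _) rBj

  step-arc : ∀ R {u v} → Arcᴰ u v → u ∈ᴿ R → v ∈ᴿ step R
  step-arc (rA , rB) {inj₂ j} {inj₁ i} bij rBj =
    trans (cong (rA i ∨_) (dec-true (Finₚ.any? _) (j , cong₂ _∧_ rBj bij))) (Boolₚ.∨-zeroʳ _)
  step-arc (rA , rB) {inj₁ i} {inj₂ j} fij rAi =
    trans (cong (rB j ∨_) (dec-true (Finₚ.any? _) (i , cong₂ _∧_ rAi fij))) (Boolₚ.∨-zeroʳ _)

  step-source : ∀ R {v} → v ∈ᴿ step R → v ∈ᴿ R ⊎ ∃ λ u → u ∈ᴿ R × Arcᴰ u v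
  step-source (rA , rB) {inj₁ i} v∈ with rA i in rAi
  ... | true  = inj₁ refl
  ... | false with does-true⇒ (Finₚ.any? _) v∈
  ...   | j , rBj∧bij = inj₂ (inj₂ j , ∧-elim rBj∧bij)
  step-source (rA , rB) {inj₂ j} v∈ with rB j in rBj
  ... | true  = inj₁ refl
  ... | false with does-true⇒ (Finₚ.any? _) v∈
  ...   | i , rAi∧fij = inj₂ (inj₁ i , ∧-elim rAi∧fij)

  Fixed : Region → Set
  Fixed R = (∀ i → proj₁ (step R) i ≡ proj₁ R i) × (∀ j → proj₂ (step R) j ≡ proj₂ R j)

  Fixed? : Decidable Fixed
  Fixed? R = Finₚ.all? (λ i → proj₁ (step R) i Boolₚ.≟ proj₁ R i) ×-dec
             Finₚ.all? (λ j → proj₂ (step R) j Boolₚ.≟ proj₂ R j)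

  fixed⇒closed : ∀ R → Fixed R → Closed R
  fixed⇒closed R (fixedA , fixedB) {v = inj₁ i} arc u∈R = trans (sym (fixedA i)) (step-arc R arc u∈R)
  fixed⇒closed R (fixedA , fixedB) {v = inj₂ j} arc u∈R = trans (sym (fixedB j)) (step-arc R arc u∈R)

  size : Region → ℕ
  size (rA , rB) = count rA + count rB

  size-≤ : ∀ R → size R ≤ p + q
  size-≤ (rA , rB) = +-mono-≤ (count-≤ rA) (count-≤ rB)

  step-grows : ∀ R → ¬ Fixed R → size R < size (step R)
  step-grows R@(rA , rB) ¬fixed with Finₚ.all? (λ i → proj₁ (step R) i Boolₚ.≟ rA i)
  ... | no ¬fixedA = +-mono-<-≤ (count-grows rA _ (λ {i} → step-⊇ R {inj₁ i}) ¬fixedA)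
                                (count-mono-≤ rB _ (λ j → step-⊇ R {inj₂ j}))
  ... | yes fixedA = +-mono-≤-< (count-mono-≤ rA _ (λ i → step-⊇ R {inj₁ i}))
                                (count-grows rB _ (λ {j} → step-⊇ R {inj₂ j}) (λ fixedB → ¬fixed (fixedA , fixedB)))

  singleton : Vertex → Region
  singleton (inj₁ i) = (λ i′ → does (i′ Finₚ.≟ i)) , (λ _ → false)
  singleton (inj₂ j) = (λ _ → false) , (λ j′ → does (j′ Finₚ.≟ j))

  ∈-singleton : ∀ c → c ∈ᴿ singleton c
  ∈-singleton (inj₁ i) = dec-true (i Finₚ.≟ i) refl
  ∈-singleton (inj₂ j) = dec-true (j Finₚ.≟ j) refl

  singleton-sole : ∀ c {v} → v ∈ᴿ singleton c → v ≡ c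
  singleton-sole (inj₁ i) {inj₁ i′} v∈ = cong inj₁ (does-true⇒ (i′ Finₚ.≟ i) v∈)
  singleton-sole (inj₂ j) {inj₂ j′} v∈ = cong inj₂ (does-true⇒ (j′ Finₚ.≟ j) v∈)

  module _ (c : Vertex) where

    ReachableFrom : Region → Set
    ReachableFrom R = ∀ {v} → v ∈ᴿ R → Star Arcᴰ c v

    step-reachable : ∀ R → ReachableFrom R → ReachableFrom (step R)
    step-reachable R reach v∈ with step-source R v∈
    ... | inj₁ v∈R               = reach v∈R
    ... | inj₂ (u , u∈R , u→v) = reach u∈R ◅◅ (u→v ◅ ε)

    saturate : ∀ fuel R → p + q < size R + fuel → ReachableFrom R →
      Σ Region λ R′ → R ⊆ᴿ R′ × Closed R′ × ReachableFrom R′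
    saturate zero R R-small _ = ⊥-elim (<⇒≱ R-small (subst (_≤ p + q) (sym (+-identityʳ _)) (size-≤ R)))
    saturate (suc fuel) R R-small reach with Fixed? R
    ... | yes fixed = R , id , fixed⇒closed R fixed , reach
    ... | no ¬fixed with saturate fuel (step R) step-small (step-reachable R reach)
      where
        step-small : p + q < size (step R) + fuel
        step-small = <-≤-trans R-small
          (≤-trans (≤-reflexive (+-suc (size R) fuel)) (+-monoˡ-≤ fuel (step-grows R ¬fixed)))
    ...   | R′ , step⊆R′ , closed , reach′ = R′ , step⊆R′ ∘ step-⊇ R , closed , reach′

    closure : Σ Region λ R → c ∈ᴿ R × Closed R × ReachableFrom R
    closure with saturate (suc (p + q)) (singleton c) (<-≤-trans (n<1+n (p + q)) (m≤n+m _ (size (singleton c))))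
                          (λ v∈ → subst (Star Arcᴰ c) (sym (singleton-sole c v∈)) ε)
    ... | R , c⊆R , closed , reach = R , c⊆R (∈-singleton c) , closed , reach

  -- Double counting the arcs at R: closure gives out ≤ in for both arc kinds, balance turns the
  -- two inequalities into a cycle, so none is strict and no arc enters R from outside.
  module _ {rA : Fin p → Bool} {rB : Fin q → Bool}
           (closed : Closed (rA , rB)) (balanced : Balanced (rA , rB)) where

    forward-out forward-in backward-out backward-in : ℕ
    forward-out  = count₂ (λ i j → rA i ∧ forward i j)
    forward-in   = count₂ (λ i j → rB j ∧ forward i j)
    backward-out = count₂ (λ i j → rB j ∧ backward i j)
    backward-in  = count₂ (λ i j → rA i ∧ backward i j)

    forward-kept : ∀ i j → rA i ∧ forward i j ≡ true → rB j ∧ forward i j ≡ true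
    forward-kept i j h with rA i in rAi | forward i j in fij
    ... | true | true = cong (_∧ true) (closed {inj₁ i} {inj₂ j} fij rAi)

    backward-kept : ∀ i j → rB j ∧ backward i j ≡ true → rA i ∧ backward i j ≡ true
    backward-kept i j h with rB j in rBj | backward i j in bij
    ... | true | true = cong (_∧ true) (closed {inj₂ j} {inj₁ i} bij rBj)

    backward-in≡forward-out : backward-in ≡ forward-out
    backward-in≡forward-out = count₂-rows rA backward forward (λ i rAi → sym (balanced (inj₁ i) rAi))

    forward-in≡backward-out : forward-in ≡ backward-out
    forward-in≡backward-out = begin
      forward-in                                   ≡⟨ count₂-transpose (λ i j → rB j ∧ forward i j) ⟩
      count₂ (λ j i → rB j ∧ forward i j)          ≡⟨ count₂-rows rB (λ j i → forward i j) (λ j i → backward i j)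
                                                       (λ j rBj → sym (balanced (inj₂ j) rBj)) ⟩
      count₂ (λ j i → rB j ∧ backward i j)         ≡⟨ count₂-transpose (λ i j → rB j ∧ backward i j) ⟨
      backward-out                                 ∎
      where open ≡-Reasoning

    forward-out≤forward-in : forward-out ≤ forward-in
    forward-out≤forward-in = count₂-mono-≤ _ _ forward-kept

    backward-out≤backward-in : backward-out ≤ backward-in
    backward-out≤backward-in = count₂-mono-≤ _ _ backward-kept

    no-arc-enters : ∀ {u v} → Arcᴰ u v → v ∈ᴿ (rA , rB) → u ∈ᴿ (rA , rB)
    no-arc-enters {inj₁ i} {inj₂ j} fij rBj with rA i in rAi
    ... | true  = refl
    ... | false = ⊥-elim (<-irrefl refl (begin-strict
      forward-out  <⟨ count₂-mono-< _ _ forward-kept i j (cong (_∧ forward i j) rAi) (cong₂ _∧_ rBj fij) ⟩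
      forward-in   ≡⟨ forward-in≡backward-out ⟩
      backward-out ≤⟨ backward-out≤backward-in ⟩
      backward-in  ≡⟨ backward-in≡forward-out ⟩
      forward-out  ∎))
      where open ≤-Reasoning
    no-arc-enters {inj₂ j} {inj₁ i} bij rAi with rB j in rBj
    ... | true  = refl
    ... | false = ⊥-elim (<-irrefl refl (begin-strict
      backward-out <⟨ count₂-mono-< _ _ backward-kept i j (cong (_∧ backward i j) rBj) (cong₂ _∧_ rAi bij) ⟩
      backward-in  ≡⟨ backward-in≡forward-out ⟩
      forward-out  ≤⟨ forward-out≤forward-in ⟩
      forward-in   ≡⟨ forward-in≡backward-out ⟩
      backward-out ∎))
      where open ≤-Reasoning

module Bipartite {p q : ℕ} (E : Fin p → Fin q → Bool) (b : Fin p ⊎ Fin q → ℕ) where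
  open Graph E b

  _≟V_ : DecidableEquality V
  _≟V_ = Sumₚ.≡-dec Finₚ._≟_ Finₚ._≟_

  _≐_ : Rel EdgeSet 0ℓ
  _≐_ = Pointwise (Pointwise _≡_)

  deg-cong : ∀ {f g} → f ≐ g → ∀ v → deg f v ≡ deg g v
  deg-cong f≐g (inj₁ i) = count-cong _ _ (f≐g i)
  deg-cong f≐g (inj₂ j) = count-cong _ _ (λ i → f≐g i j)

  size-cong : ∀ {f g} → f ≐ g → size f ≡ size g
  size-cong f≐g = sumF-cong _ _ (λ i → deg-cong f≐g (inj₁ i))

  IsBMatching-resp : IsBMatching Respects _≐_
  IsBMatching-resp f≐g (f⊆E , f≤b) =
    (λ i j gij → f⊆E i j (trans (f≐g i j) gij)) , (λ v → subst (_≤ b v) (deg-cong f≐g v) (f≤b v))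

  all-vertices? : {P : V → Set} → Decidable P → Dec (∀ v → P v)
  all-vertices? P? = map′ (λ (A , B) → λ { (inj₁ i) → A i ; (inj₂ j) → B j }) (λ all → all ∘ inj₁ , all ∘ inj₂)
    (Finₚ.all? (P? ∘ inj₁) ×-dec Finₚ.all? (P? ∘ inj₂))

  IsBMatching? : Decidable IsBMatching
  IsBMatching? f =
    Finₚ.all? (λ i → Finₚ.all? λ j → (f i j Boolₚ.≟ true) →-dec (E i j Boolₚ.≟ true))
    ×-dec all-vertices? (λ v → deg f v ≤? b v)

  disagreeing-maxima-flexible : ∀ {f g i j} → IsMaxBMatching f → IsMaxBMatching g →
    f i j ≡ true → g i j ≡ false → Flexible i j
  disagreeing-maxima-flexible {f} {g} {i} {j} f-max g-max fij gij =
    (proj₁ (proj₁ f-max) i j fij , f , f-max , fij) ,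
    λ (_ , in-all) → case trans (sym (in-all g g-max)) gij of λ ()

  FlexAdj-sym : ∀ {x y} → FlexAdj x y → FlexAdj y x
  FlexAdj-sym {inj₁ _} {inj₂ _} flex = flex
  FlexAdj-sym {inj₂ _} {inj₁ _} flex = flex

  component : V → V → Set
  component = Star FlexAdj

  component-sym : ∀ {x y} → component x y → component y x
  component-sym = Star.reverse FlexAdj-sym

  component-IsFlexComp : ∀ x → IsFlexComp (component x)
  component-IsFlexComp x = x , λ _ → id , id

  IsFlexComp⇒component : ∀ {S x} → IsFlexComp S → S x → SameSet S (component x)
  IsFlexComp⇒component {S} {x} (v , S≐v) Sx w =
    (λ Sw → component-sym v⇝x ◅◅ proj₁ (S≐v w) Sw) , (λ x⇝w → proj₂ (S≐v w) (v⇝x ◅◅ x⇝w))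
    where v⇝x = proj₁ (S≐v x) Sx

  side : V → Side
  side (inj₁ _) = sideA
  side (inj₂ _) = sideB

  InSide-side : ∀ v → InSide (side v) v
  InSide-side (inj₁ _) = tt
  InSide-side (inj₂ _) = tt

  V₀⇒¬X : ∀ {u} → V₀ u → ∀ W → ¬ X W u
  V₀⇒¬X (¬Xᴬ , _) sideA = ¬Xᴬ
  V₀⇒¬X (_ , ¬Xᴮ) sideB = ¬Xᴮ

  V₀⇒component-consistent : ∀ {u} → V₀ u → Consistent (component u)
  V₀⇒component-consistent {u} u∈V₀ = component-IsFlexComp u , no-𝒟 , no-singleton
    where
      no-𝒟 : ¬ (∃ λ v → component u v × 𝒟 v)
      no-𝒟 (v , u⇝v , v∈𝒟) =
        V₀⇒¬X u∈V₀ (side v) (component u , (component-IsFlexComp u , inj₁ (v , u⇝v , v∈𝒟 , InSide-side v)) , ε)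
      no-singleton : ¬ SingletonZeroNextTo (component u) (λ _ → ⊤)
      no-singleton (v , only-v , bv≡0 , w , v~w , w∈𝒟 , _) =
        V₀⇒¬X u∈V₀ (side w)
          (component u , (component-IsFlexComp u , inj₂ (v , only-v , bv≡0 , w , v~w , w∈𝒟 , InSide-side w)) , ε)

  consistent⇒V₀ : ∀ {C x} → Consistent C → C x → V₀ x
  consistent⇒V₀ {C} {x} (C-comp , no-𝒟 , no-singleton) Cx = ¬X sideA , ¬X sideB
    where
      C≐x = IsFlexComp⇒component C-comp Cx
      ¬X : ∀ W → ¬ X W x
      ¬X W (S , (S-comp , inj₁ (v , Sv , v∈𝒟 , _)) , Sx) =
        no-𝒟 (v , proj₂ (C≐x v) (proj₁ (IsFlexComp⇒component S-comp Sx v) Sv) , v∈𝒟)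
      ¬X W (S , (S-comp , inj₂ (v , only-v , bv≡0 , w , v~w , w∈𝒟 , _)) , Sx) =
        no-singleton (v , (λ y → proj₁ (only-v y) ∘ proj₂ (S≐x y) ∘ proj₁ (C≐x y) ,
                              proj₂ (C≐x y) ∘ proj₁ (S≐x y) ∘ proj₂ (only-v y)) ,
                      bv≡0 , w , v~w , w∈𝒟 , tt)
        where S≐x = IsFlexComp⇒component S-comp Sx

  component-V₀ : ∀ {u v} → V₀ u → component u v → V₀ v
  component-V₀ u∈V₀ = consistent⇒V₀ (V₀⇒component-consistent u∈V₀)

  V₀⇒¬𝒟 : ∀ {v} → V₀ v → ¬ 𝒟 v
  V₀⇒¬𝒟 {v} v∈V₀ v∈𝒟 = proj₁ (proj₂ (V₀⇒component-consistent v∈V₀)) (v , ε , v∈𝒟)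

  ¬𝒟⇒saturated : ∀ {v f} → ¬ 𝒟 v → IsMaxBMatching f → deg f v ≡ b v
  ¬𝒟⇒saturated {v} {f} v∉𝒟 f-max = ≤-antisym (proj₂ (proj₁ f-max) v) (≮⇒≥ λ loose → v∉𝒟 (f , f-max , loose))

  module _ {M : EdgeSet} (M-max : IsMaxBMatching M) where

    -- Maximality quantifies over all edge sets; against a fixed maximum M it becomes decidable.
    IsMax⇔AtLeastM : ∀ f → IsMaxBMatching f ⇔ (IsBMatching f × size M ≤ size f)
    IsMax⇔AtLeastM f = (λ (f-bm , f-max) → f-bm , f-max M (proj₁ M-max)) ,
                       (λ (f-bm , M≤f) → f-bm , λ g g-bm → ≤-trans (proj₂ M-max g g-bm) M≤f)

    maximum-with? : ∀ i j v → Dec (∃ λ f → IsMaxBMatching f × f i j ≡ v)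
    maximum-with? i j v =
      map′ (λ (f , (f-bm , M≤f) , fij) → f , proj₂ (IsMax⇔AtLeastM f) (f-bm , M≤f) , fij)
           (λ (f , f-max , fij) → f , proj₁ (IsMax⇔AtLeastM f) f-max , fij)
           (search-Vector p (λ _ → refl) (search-Vector q refl search-Bool) Good Good-resp Good?)
      where
        Good : Pred EdgeSet 0ℓ
        Good f = (IsBMatching f × size M ≤ size f) × f i j ≡ v

        Good-resp : Good Respects _≐_
        Good-resp f≐g ((f-bm , M≤f) , fij) =
          (IsBMatching-resp f≐g f-bm , subst (size M ≤_) (size-cong f≐g) M≤f) , trans (sym (f≐g i j)) fij

        Good? : Decidable Good
        Good? f = (IsBMatching? f ×-dec (size M ≤? size f)) ×-dec (f i j Boolₚ.≟ v)

    avoided-or-inevitable : ∀ {i j} → Allowed i j → (∃ λ f → IsMaxBMatching f × f i j ≡ false) ⊎ Inevitable i j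
    avoided-or-inevitable {i} {j} allowed with maximum-with? i j false
    ... | yes avoided = inj₁ avoided
    ... | no ¬avoided = inj₂ (allowed , λ g g-max → Boolₚ.¬-not λ gij → ¬avoided (g , g-max , gij))

    flexible⇒avoided : ∀ {i j} → Flexible i j → ∃ λ f → IsMaxBMatching f × f i j ≡ false
    flexible⇒avoided (allowed , ¬inevitable) with avoided-or-inevitable allowed
    ... | inj₁ avoided    = avoided
    ... | inj₂ inevitable = ⊥-elim (¬inevitable inevitable)

    matched⇒flexible⊎inevitable : ∀ {i j} → M i j ≡ true → Flexible i j ⊎ Inevitable i j
    matched⇒flexible⊎inevitable {i} {j} Mij
      with avoided-or-inevitable (proj₁ (proj₁ M-max) i j Mij , M , M-max , Mij)
    ... | inj₁ (f , f-max , fij) = inj₁ (disagreeing-maxima-flexible M-max f-max Mij fij)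
    ... | inj₂ inevitable        = inj₂ inevitable

    unmatched⇒flexible⊎forbidden : ∀ {i j} → E i j ≡ true → M i j ≡ false → Flexible i j ⊎ Forbidden i j
    unmatched⇒flexible⊎forbidden {i} {j} Eij Mij with maximum-with? i j true
    ... | yes (f , f-max , fij) = inj₁ (disagreeing-maxima-flexible f-max M-max fij Mij)
    ... | no ¬used              = inj₂ (Eij , λ (_ , used) → ¬used used)

    Arc-from-A : ∀ {i t} → Arc M (inj₁ i) t → ∃ λ j → inj₂ j ≡ t
    Arc-from-A {t = inj₂ j} _ = j , refl

    Arc-from-B : ∀ {j t} → Arc M (inj₂ j) t → ∃ λ i → inj₁ i ≡ t
    Arc-from-B {t = inj₁ i} _ = i , refl

    Arc-into-A : ∀ {i s} → Arc M s (inj₁ i) → ∃ λ j → inj₂ j ≡ s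
    Arc-into-A {s = inj₂ j} _ = j , refl

    Arc-into-B : ∀ {j s} → Arc M s (inj₂ j) → ∃ λ i → inj₁ i ≡ s
    Arc-into-B {s = inj₁ i} _ = i , refl

    Arc-matched : ∀ {i j} → Arc M (inj₁ i) (inj₂ j) → M i j ≡ true
    Arc-matched (_ , _ , _ , Mij) = Mij

    Arc-unmatched : ∀ {i j} → Arc M (inj₂ j) (inj₁ i) → M i j ≡ false
    Arc-unmatched (_ , _ , _ , Mij) = Mij

    Arc-edgeᴬᴮ : ∀ {i j} → Arc M (inj₁ i) (inj₂ j) → E i j ≡ true
    Arc-edgeᴬᴮ (_ , _ , Eij , _) = Eij

    Arc-edgeᴮᴬ : ∀ {i j} → Arc M (inj₂ j) (inj₁ i) → E i j ≡ true
    Arc-edgeᴮᴬ (_ , _ , Eij , _) = Eij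

    Arc-target-V₀ : ∀ {x y} → Arc M x y → V₀ y
    Arc-target-V₀ {inj₁ _} {inj₂ _} (_ , y∈V₀ , _) = y∈V₀
    Arc-target-V₀ {inj₂ _} {inj₁ _} (y∈V₀ , _ , _) = y∈V₀

    -- An arc on a directed cycle of H is flexible

    module AlternatingCycle {x y : V} (x→y : Arc M x y) (y⇝x : Reach M y x) where
      open Walks _≟V_

      path : Reach M y x
      path = proj₁ (erase-loops y⇝x)

      cycle : Reach M x x
      cycle = x→y ◅ path

      L : List (V × V)
      L = arcs cycle

      outdegree-≤1 : ∀ u → outdegree u L ≤ 1
      outdegree-≤1 u rewrite outdegree≡occ u cycle with x ≟V u | proj₂ (erase-loops y⇝x)
      ... | yes refl | _ , x∉path = ≤-reflexive (cong suc x∉path)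
      ... | no _     | ≤1 , _     = ≤1 u

      indegree-≤1 : ∀ u → indegree u L ≤ 1
      indegree-≤1 u = subst (_≤ 1) (closed-walk-balance u cycle) (outdegree-≤1 u)

      module _ (u : V) {n : ℕ} (nbr : Fin n → V) (nbr-injective : ∀ {k k′} → nbr k ≡ nbr k′ → k ≡ k′) where

        count-out-arcs : (∀ {t} → Arc M u t → ∃ λ k → nbr k ≡ t) →
          count (λ k → does ((u , nbr k) ∈? L)) ≡ outdegree u L
        count-out-arcs out-nbr = count-∈≡occurrences (λ k → u , nbr k) (nbr-injective ∘ cong proj₂)
          ((_== u) ∘ proj₁) (λ _ → dec-true (u ≟V u) refl) L (outdegree-≤1 u) covered
          where
            covered : ∀ {e} → e ∈ L → ((_== u) ∘ proj₁) e ≡ true → ∃ λ k → (u , nbr k) ≡ e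
            covered {s , t} e∈L s≡u with does-true⇒ (s ≟V u) s≡u
            ... | refl with out-nbr (∈-arcs⇒R cycle e∈L)
            ...   | k , refl = k , refl

        count-in-arcs : (∀ {s} → Arc M s u → ∃ λ k → nbr k ≡ s) →
          count (λ k → does ((nbr k , u) ∈? L)) ≡ indegree u L
        count-in-arcs in-nbr = count-∈≡occurrences (λ k → nbr k , u) (nbr-injective ∘ cong proj₁)
          ((_== u) ∘ proj₂) (λ _ → dec-true (u ≟V u) refl) L (indegree-≤1 u) covered
          where
            covered : ∀ {e} → e ∈ L → ((_== u) ∘ proj₂) e ≡ true → ∃ λ k → (nbr k , u) ≡ e
            covered {s , t} e∈L t≡u with does-true⇒ (t ≟V u) t≡u
            ... | refl with in-nbr (∈-arcs⇒R cycle e∈L)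
            ...   | k , refl = k , refl

        in-out-balanced : (∀ {t} → Arc M u t → ∃ λ k → nbr k ≡ t) → (∀ {s} → Arc M s u → ∃ λ k → nbr k ≡ s) →
          count (λ k → does ((u , nbr k) ∈? L)) ≡ count (λ k → does ((nbr k , u) ∈? L))
        in-out-balanced out-nbr in-nbr =
          trans (count-out-arcs out-nbr) (trans (closed-walk-balance u cycle) (sym (count-in-arcs in-nbr)))

      on-cycle : Fin p → Fin q → Bool
      on-cycle i j = does ((inj₁ i , inj₂ j) ∈? L) ∨ does ((inj₂ j , inj₁ i) ∈? L)

      flipped : EdgeSet
      flipped i j = M i j xor on-cycle i j

      forward-arc : ∀ {i j} → does ((inj₁ i , inj₂ j) ∈? L) ≡ true → Arc M (inj₁ i) (inj₂ j)
      forward-arc {i} {j} ∈L = ∈-arcs⇒R cycle (does-true⇒ ((inj₁ i , inj₂ j) ∈? L) ∈L)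

      backward-arc : ∀ {i j} → does ((inj₂ j , inj₁ i) ∈? L) ≡ true → Arc M (inj₂ j) (inj₁ i)
      backward-arc {i} {j} ∈L = ∈-arcs⇒R cycle (does-true⇒ ((inj₂ j , inj₁ i) ∈? L) ∈L)

      deg-flipped : ∀ v → deg flipped v ≡ deg M v
      deg-flipped (inj₁ i) = count-xor-preserved (M i) _ _
        (λ j → Arc-matched ∘ forward-arc) (λ j → Arc-unmatched ∘ backward-arc)
        (in-out-balanced (inj₁ i) inj₂ Sumₚ.inj₂-injective Arc-from-A Arc-into-A)
      deg-flipped (inj₂ j) = count-xor-preserved (λ i → M i j) _ _
        (λ i → Arc-matched ∘ forward-arc) (λ i → Arc-unmatched ∘ backward-arc)
        (sym (in-out-balanced (inj₂ j) inj₁ Sumₚ.inj₁-injective Arc-from-B Arc-into-B))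

      flipped⊆E : ∀ i j → flipped i j ≡ true → E i j ≡ true
      flipped⊆E i j flipped-ij
        with M i j in Mij | does ((inj₁ i , inj₂ j) ∈? L) in fwd | does ((inj₂ j , inj₁ i) ∈? L) in bwd
      ... | true  | _     | _    = proj₁ (proj₁ M-max) i j Mij
      ... | false | true  | _    = Arc-edgeᴬᴮ (forward-arc fwd)
      ... | false | false | true = Arc-edgeᴮᴬ (backward-arc bwd)

      flipped-max : IsMaxBMatching flipped
      flipped-max = proj₂ (IsMax⇔AtLeastM flipped)
        ( (flipped⊆E , λ v → subst (_≤ b v) (sym (deg-flipped v)) (proj₂ (proj₁ M-max) v))
        , ≤-reflexive (sym (sumF-cong _ _ (deg-flipped ∘ inj₁))))

      flexible-on-cycle : ∀ {s t} → Arc M s t → (s , t) ∈ L → FlexAdj s t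
      flexible-on-cycle {inj₁ i} {inj₂ j} (_ , _ , _ , Mij) st∈L =
        disagreeing-maxima-flexible M-max flipped-max Mij flipped-ij
        where
          flipped-ij : flipped i j ≡ false
          flipped-ij rewrite Mij | dec-true ((inj₁ i , inj₂ j) ∈? L) st∈L = refl
      flexible-on-cycle {inj₂ j} {inj₁ i} (_ , _ , _ , Mij) st∈L =
        disagreeing-maxima-flexible flipped-max M-max flipped-ij Mij
        where
          flipped-ij : flipped i j ≡ true
          flipped-ij rewrite Mij | dec-true ((inj₂ j , inj₁ i) ∈? L) st∈L
                           | Boolₚ.∨-zeroʳ (does ((inj₁ i , inj₂ j) ∈? L)) = refl

    arc-on-cycle-flexible : ∀ {x y} → Arc M x y → Reach M y x → FlexAdj x y
    arc-on-cycle-flexible x→y y⇝x = flexible-on-cycle x→y (here refl)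
      where open AlternatingCycle x→y y⇝x

    -- A flexible arc of H lies on a directed cycle

    flexible⇒maximum-disagreeing : ∀ {i j} → Flexible i j → ∃ λ f → IsMaxBMatching f × f i j ≡ not (M i j)
    flexible⇒maximum-disagreeing {i} {j} flexible with M i j
    ... | true  = flexible⇒avoided flexible
    ... | false = proj₂ (proj₁ flexible)

    module Exchange {M′ : EdgeSet} (M′-max : IsMaxBMatching M′) where

      lost gained : Fin p → Fin q → Bool
      lost   i j = M i j ∧ not (M′ i j)
      gained i j = M′ i j ∧ not (M i j)

      open Regions lost gained public

      Arcᴰ-flexible : ∀ {u v} → Arcᴰ u v → FlexAdj u v
      Arcᴰ-flexible {inj₁ i} {inj₂ j} lost-ij with ∧-elim {M i j} lost-ij
      ... | Mij , ¬M′ij = disagreeing-maxima-flexible M-max M′-max Mij (Boolₚ.not-injective ¬M′ij)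
      Arcᴰ-flexible {inj₂ j} {inj₁ i} gained-ij with ∧-elim {M′ i j} gained-ij
      ... | M′ij , ¬Mij = disagreeing-maxima-flexible M′-max M-max M′ij (Boolₚ.not-injective ¬Mij)

      Arcᴰ⇒Arc : ∀ {u v} → V₀ u → Arcᴰ u v → Arc M u v
      Arcᴰ⇒Arc {inj₁ i} {inj₂ j} u∈V₀ lost-ij =
        u∈V₀ , component-V₀ u∈V₀ (Arcᴰ-flexible {inj₁ i} {inj₂ j} lost-ij ◅ ε) ,
        proj₁ (proj₁ M-max) i j Mij , Mij
        where Mij = proj₁ (∧-elim {M i j} lost-ij)
      Arcᴰ⇒Arc {inj₂ j} {inj₁ i} u∈V₀ gained-ij =
        component-V₀ u∈V₀ (Arcᴰ-flexible {inj₂ j} {inj₁ i} gained-ij ◅ ε) , u∈V₀ ,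
        proj₁ (proj₁ M′-max) i j M′ij ,
        Boolₚ.not-injective (proj₂ (∧-elim {M′ i j} gained-ij))
        where M′ij = proj₁ (∧-elim {M′ i j} gained-ij)

      Arcᴰ-walk⇒Reach : ∀ {u v} → V₀ u → Star Arcᴰ u v → Reach M u v
      Arcᴰ-walk⇒Reach u∈V₀ ε            = ε
      Arcᴰ-walk⇒Reach u∈V₀ (u→w ◅ w⇝v) =
        Arcᴰ⇒Arc u∈V₀ u→w ◅ Arcᴰ-walk⇒Reach (component-V₀ u∈V₀ (Arcᴰ-flexible u→w ◅ ε)) w⇝v

      Arcᴰ-walk-V₀ : ∀ {u v} → V₀ u → Star Arcᴰ u v → V₀ v
      Arcᴰ-walk-V₀ u∈V₀ u⇝v = component-V₀ u∈V₀ (Star.map Arcᴰ-flexible u⇝v)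

      saturated-both : ∀ {v} → ¬ 𝒟 v → deg M v ≡ deg M′ v
      saturated-both v∉𝒟 = trans (¬𝒟⇒saturated v∉𝒟 M-max) (sym (¬𝒟⇒saturated v∉𝒟 M′-max))

      balanced-at : ∀ v → ¬ 𝒟 v → outdeg v ≡ indeg v
      balanced-at (inj₁ i) v∉𝒟 = count-differences (M i) (M′ i) (saturated-both v∉𝒟)
      balanced-at (inj₂ j) v∉𝒟 = sym (count-differences (λ i → M i j) (λ i → M′ i j) (saturated-both v∉𝒟))

      arc-reversible : ∀ {x y} → V₀ y → Arcᴰ x y → Star Arcᴰ y x
      arc-reversible {x} {y} y∈V₀ x→y with closure y
      ... | R , y∈R , closed , reach = reach (no-arc-enters closed balanced x→y y∈R)
        where
          balanced : Balanced R
          balanced v v∈R = balanced-at v (V₀⇒¬𝒟 (Arcᴰ-walk-V₀ y∈V₀ (reach v∈R)))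

    flexible-arc-reversible : ∀ {x y} → Arc M x y → FlexAdj x y → Reach M y x
    flexible-arc-reversible {inj₁ i} {inj₂ j} (_ , y∈V₀ , _ , Mij) flexible
      with flexible⇒maximum-disagreeing flexible
    ... | M′ , M′-max , M′ij = Arcᴰ-walk⇒Reach y∈V₀ (arc-reversible y∈V₀ lost-ij)
      where
        open Exchange M′-max
        lost-ij : lost i j ≡ true
        lost-ij rewrite M′ij | Mij = refl
    flexible-arc-reversible {inj₂ j} {inj₁ i} (y∈V₀ , _ , _ , Mij) flexible
      with flexible⇒maximum-disagreeing flexible
    ... | M′ , M′-max , M′ij = Arcᴰ-walk⇒Reach y∈V₀ (arc-reversible y∈V₀ gained-ij)
      where
        open Exchange M′-max
        gained-ij : gained i j ≡ true
        gained-ij rewrite M′ij | Mij = refl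

    flexible-strongly-connected : ∀ {x y} → V₀ x → FlexAdj x y → Reach M x y × Reach M y x
    flexible-strongly-connected {inj₁ i} {inj₂ j} x∈V₀ flexible with M i j in Mij
    ... | true  = x→y ◅ ε , flexible-arc-reversible x→y flexible
      where x→y = x∈V₀ , component-V₀ x∈V₀ (flexible ◅ ε) , proj₁ (proj₁ flexible) , Mij
    ... | false = flexible-arc-reversible y→x flexible , y→x ◅ ε
      where y→x = x∈V₀ , component-V₀ x∈V₀ (flexible ◅ ε) , proj₁ (proj₁ flexible) , Mij
    flexible-strongly-connected {inj₂ j} {inj₁ i} x∈V₀ flexible =
      swap (flexible-strongly-connected (component-V₀ x∈V₀ (flexible ◅ ε)) flexible)

    strongly-connected⇒component : ∀ {x y} → Reach M x y → Reach M y x → component x y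
    strongly-connected⇒component ε             _   = ε
    strongly-connected⇒component (x→w ◅ w⇝y) y⇝x =
      arc-on-cycle-flexible x→w (w⇝y ◅◅ y⇝x) ◅ strongly-connected⇒component w⇝y (y⇝x ◅◅ (x→w ◅ ε))

    component⇒strongly-connected : ∀ {x y} → V₀ x → component x y → Reach M x y × Reach M y x
    component⇒strongly-connected x∈V₀ ε = ε , ε
    component⇒strongly-connected x∈V₀ (x~w ◅ w⇝y)
      with flexible-strongly-connected x∈V₀ x~w | component⇒strongly-connected (component-V₀ x∈V₀ (x~w ◅ ε)) w⇝y
    ... | x→w , w→x | w→y , y→w = x→w ◅◅ w→y , y→w ◅◅ w→x

    scc⇒consistent-component : ∀ K → IsSCC M K → Σ (V → Set) λ C → Consistent C × SameSet K C
    scc⇒consistent-component K (u , u∈V₀ , K≐) =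
      component u , V₀⇒component-consistent u∈V₀ ,
      λ w → (λ Kw → let (_ , u⇝w , w⇝u) = proj₁ (K≐ w) Kw in strongly-connected⇒component u⇝w w⇝u) ,
            (λ u~w → proj₂ (K≐ w) (component-V₀ u∈V₀ u~w , component⇒strongly-connected u∈V₀ u~w))

    consistent⇒scc : ∀ C → Consistent C → Σ (V → Set₁) λ K → IsSCC M K × SameSet K C
    consistent⇒scc C C-consistent@((v , C≐v) , _) = K , (v , v∈V₀ , λ w → id , id) , K≐C
      where
        K : V → Set₁
        K w = V₀ w × Reach M v w × Reach M w v
        v∈V₀ : V₀ v
        v∈V₀ = consistent⇒V₀ C-consistent (proj₂ (C≐v v) ε)
        K≐C : SameSet K C
        K≐C w = (λ (_ , v⇝w , w⇝v) → proj₂ (C≐v w) (strongly-connected⇒component v⇝w w⇝v)) ,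
                (λ Cw → consistent⇒V₀ C-consistent Cw , component⇒strongly-connected v∈V₀ (proj₁ (C≐v w) Cw))

    flexible⇒same-component : ∀ {x y} → FlexAdj x y → SameSet (component x) (component y)
    flexible⇒same-component x~y w = (FlexAdj-sym x~y ◅_) , (x~y ◅_)

    Arc⇒PreA : ∀ {x y} → Arc M x y → PreA (component x) (component y)
    Arc⇒PreA {inj₁ i} {inj₂ j} (_ , _ , _ , Mij) with matched⇒flexible⊎inevitable Mij
    ... | inj₁ flexible   = inj₁ (flexible⇒same-component {inj₁ i} {inj₂ j} flexible)
    ... | inj₂ inevitable = inj₂ (inj₁ (lift (i , j , inevitable , ε , ε)))
    Arc⇒PreA {inj₂ j} {inj₁ i} (_ , _ , Eij , Mij) with unmatched⇒flexible⊎forbidden Eij Mij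
    ... | inj₁ flexible  = inj₁ (flexible⇒same-component {inj₂ j} {inj₁ i} flexible)
    ... | inj₂ forbidden = inj₂ (inj₂ (lift (i , j , forbidden , ε , ε)))

    Reach⇒LeA : ∀ {x y} → V₀ x → Reach M x y → LeA (component x) (component y)
    Reach⇒LeA x∈V₀ ε             = single (V₀⇒component-consistent x∈V₀)
    Reach⇒LeA x∈V₀ (x→w ◅ w⇝y) =
      step (V₀⇒component-consistent x∈V₀) (Arc⇒PreA x→w) (Reach⇒LeA (Arc-target-V₀ x→w) w⇝y)

    LeA-extendʳ : ∀ {C D D′} → LeA C D → Consistent D′ → SameSet D D′ → LeA C D′
    LeA-extendʳ (single C-consistent) D′-consistent D≐D′ =
      step C-consistent (inj₁ D≐D′) (single D′-consistent)
    LeA-extendʳ (step C-consistent C⪯ ≤D) D′-consistent D≐D′ =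
      step C-consistent C⪯ (LeA-extendʳ ≤D D′-consistent D≐D′)

    LeA-consistentˡ : ∀ {C C′} → LeA C C′ → Consistent C
    LeA-consistentˡ (single C-consistent)   = C-consistent
    LeA-consistentˡ (step C-consistent _ _) = C-consistent

    consistent-strongly-connected : ∀ {C x y} → Consistent C → C x → C y → Reach M x y
    consistent-strongly-connected C-consistent Cx Cy =
      proj₁ (component⇒strongly-connected (consistent⇒V₀ C-consistent Cx)
               (proj₁ (IsFlexComp⇒component (proj₁ C-consistent) Cx _) Cy))

    LeA⇒Reach : ∀ {C C′} → LeA C C′ → ∀ {x y} → C x → C′ y → Reach M x y
    LeA⇒Reach (single C-consistent) Cx Cy = consistent-strongly-connected C-consistent Cx Cy
    LeA⇒Reach (step _ (inj₁ C≐D) ≤C′) {x} Cx C′y = LeA⇒Reach ≤C′ (proj₁ (C≐D x) Cx) C′y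
    LeA⇒Reach (step C-consistent (inj₂ (inj₁ (lift (i , j , inevitable , Ci , Dj)))) ≤C′) Cx C′y =
      consistent-strongly-connected C-consistent Cx Ci ◅◅ (i→j ◅ LeA⇒Reach ≤C′ Dj C′y)
      where
        i→j : Arc M (inj₁ i) (inj₂ j)
        i→j = consistent⇒V₀ C-consistent Ci , consistent⇒V₀ (LeA-consistentˡ ≤C′) Dj ,
              proj₁ (proj₁ inevitable) , proj₂ inevitable M M-max
    LeA⇒Reach (step C-consistent (inj₂ (inj₂ (lift (i , j , forbidden , Di , Cj)))) ≤C′) Cx C′y =
      consistent-strongly-connected C-consistent Cx Cj ◅◅ (j→i ◅ LeA⇒Reach ≤C′ Di C′y)
      where
        Mij : M i j ≡ false
        Mij = Boolₚ.¬-not λ Mij → proj₂ forbidden (proj₁ forbidden , M , M-max , Mij)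
        j→i : Arc M (inj₂ j) (inj₁ i)
        j→i = consistent⇒V₀ (LeA-consistentˡ ≤C′) Di , consistent⇒V₀ C-consistent Cj , proj₁ forbidden , Mij

    path⇒LeA : ∀ {K K′ C C′} → Consistent C → Consistent C′ → SameSet K C → SameSet K′ C′ →
      PathBetween M K K′ → LeA C C′
    path⇒LeA C-consistent C′-consistent K≐C K′≐C′ (x , y , Kx , K′y , x⇝y) =
      step C-consistent (inj₁ (IsFlexComp⇒component (proj₁ C-consistent) Cx))
        (LeA-extendʳ (Reach⇒LeA (consistent⇒V₀ C-consistent Cx) x⇝y) C′-consistent
          (λ w → swap (IsFlexComp⇒component (proj₁ C′-consistent) C′y w)))
      where
        Cx = proj₁ (K≐C x) Kx
        C′y = proj₁ (K′≐C′ y) K′y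

    LeA⇒path : ∀ {K K′ C C′} → IsSCC M K → IsSCC M K′ → SameSet K C → SameSet K′ C′ →
      LeA C C′ → PathBetween M K K′
    LeA⇒path (u , u∈V₀ , K≐) (u′ , u′∈V₀ , K′≐) K≐C K′≐C′ C≤C′ =
      u , u′ , Ku , K′u′ , LeA⇒Reach C≤C′ (proj₁ (K≐C u) Ku) (proj₁ (K′≐C′ u′) K′u′)
      where
        Ku = proj₂ (K≐ u) (u∈V₀ , ε , ε)
        K′u′ = proj₂ (K′≐ u′) (u′∈V₀ , ε , ε)

mainTheorem20 : (p q : ℕ) (E : Fin p → Fin q → Bool) (b : Fin p ⊎ Fin q → ℕ)
    (M : Fin p → Fin q → Bool) →
    Graph.IsMaxBMatching E b M →
    (∃ λ v → Graph.V₀ E b v) →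
    ((∀ K → Graph.IsSCC E b M K →
        Σ (Graph.V E b → Set) λ C → Graph.Consistent E b C × Graph.SameSet E b K C)
     × (∀ C → Graph.Consistent E b C →
        Σ (Graph.V E b → Set₁) λ K → Graph.IsSCC E b M K × Graph.SameSet E b K C))
    × (∀ K K' C C' → Graph.IsSCC E b M K → Graph.IsSCC E b M K' →
        Graph.Consistent E b C → Graph.Consistent E b C' →
        Graph.SameSet E b K C → Graph.SameSet E b K' C' →
        (Graph.PathBetween E b M K K' ⇔ Graph.LeA E b C C'))
mainTheorem20 p q E b M M-max _ =
  (scc⇒consistent-component M-max , consistent⇒scc M-max) ,
  λ K K′ C C′ K-scc K′-scc C-consistent C′-consistent K≐C K′≐C′ →
    path⇒LeA M-max C-consistent C′-consistent K≐C K′≐C′ ,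
    LeA⇒path M-max K-scc K′-scc K≐C K′≐C′
  where open Bipartite E b
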